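{- Let $\mathbb{F}$ be an infinite field of characteristic $0$ and let $n$ be a positive integer. Then neither $(\mathcal{M}_n(\mathbb{F}),\mathbb{F},+,\times_\mathbb{F},|\ast|)$ nor $(\mathcal{M}_n(\mathbb{F}),\mathbb{F},+,+_\mathbb{F},\times_\mathbb{F},|\ast|)$ is an $\vec{e}$-Ramsey algebra for any nonconstant $\vec{e}\in\Omega_0$.
   Context: An algebra is a pair $(\{A_\xi\}_{\xi\in I},\mathcal{F})$ with nonempty, pairwise disjoint phyla and a family $\mathcal{F}$ of operations, each with domain a finite product of phyla and codomain a phylum. A sort is $\vec{e}\in{}^\omega I$, and $\vec{b}$ is $\vec{e}$-sorted if $\vec{b}(i)\in A_{\vec{e}(i)}$ for all $i$. Orderly terms: $\mathcal{F}_0=\mathcal{F}\cup\{\mathrm{id}_{A_\xi}\}$. $\mathcal{F}_{k+1}$ is $\mathcal{F}_k$ plus all $f$ with $f(\vec{x})=g(h_1(\vec{x}_1),\dots,h_N(\vec{x}_N))$, where $g\in\mathcal{F}$ is $N$-ary, $h_i\in\mathcal{F}_k$, and $\vec{x}_1\ast\cdots\ast\vec{x}_N=\vec{x}$ is the argument list of $f$ (concatenation). $\mathrm{OT}(\mathcal{F})=\bigcup_k\mathcal{F}_k$. $\vec{a}\le_\mathcal{F}\vec{b}$ means: for each $j$ there are a finite subsequence $\vec{b}_j$ of $\vec{b}$ and $f_j\in\mathrm{OT}(\mathcal{F})$ with $\vec{a}(j)=f_j(\vec{b}_j)$, and $\vec{b}_0\ast\vec{b}_1\ast\cdots$ is a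 subsequence of $\vec{b}$. $\mathrm{FR}^{\vec{e}}_\mathcal{F}(\vec{b})=\{\vec{a}(0):\vec{a}\le_\mathcal{F}\vec{b},\ \vec{a}\ \vec{e}\text{ -sorted}\}$. $\vec{e}$-Ramsey algebra: for every $\vec{e}$-sorted $\vec{b}$ and $X\subseteq A_{\vec{e}(0)}$ some $\vec{e}$-sorted $\vec{a}\le_\mathcal{F}\vec{b}$ has $\mathrm{FR}^{\vec{e}}_\mathcal{F}(\vec{a})\subseteq X$ or disjoint from $X$. $\Omega$ is the set of sorts each of whose values is taken infinitely often, and $\Omega_0=\{\vec{e}\in\Omega:\vec{e}(0)=0\}$. The phyla are $A_0=\mathbb{F}$ (index $0$) and $A_1=\mathcal{M}_n(\mathbb{F})$ of $n\times n$ matrices over $\mathbb{F}$ (index $1$), regarded as disjoint. The operations are: $+$ matrix addition, $+_\mathbb{F}$ and $\times_\mathbb{F}$ field addition and multiplication, and $|\ast|:\mathcal{M}_n(\mathbb{F})\to\mathbb{F}$ the determinant. The algebra $(\mathcal{M}_n(\mathbb{F}),\mathbb{F},\text{ops})$ has both phyla and exactly the listed operations. -}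

module Defs where

open import Level using (Level; _⊔_; 0ℓ) renaming (suc to lsuc)
open import Data.Nat using (ℕ; zero; suc; _<_; _≤_)
open import Data.Fin using (Fin; zero; suc; punchIn)
open import Data.List using (List; []; _∷_; _++_; map)
open import Data.List.Membership.Propositional using (_∈_)
open import Data.List.Relation.Unary.Any using (Any)
open import Data.Product using (Σ; ∃; _×_; _,_)
open import Data.Sum using (_⊎_)
open import Data.Unit.Polymorphic using (⊤)
open import Relation.Nullary using (¬_)
open import Relation.Binary.PropositionalEquality using (_≡_)
open import Algebra.Bundles using (CommutativeRing)

record Field c ℓ : Set (lsuc (c ⊔ ℓ)) where
  field
    commutativeRing : CommutativeRing c ℓ
  open CommutativeRing commutativeRing public
  field
    1≉0     : ¬ (1# ≈ 0#)
    inverse : ∀ x → ¬ (x ≈ 0#) → ∃ λ y → (x * y) ≈ 1#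

module _ {c ℓ} (F : Field c ℓ) where
  open Field F using (Carrier; _≈_; _+_; _*_; -_; 0#; 1#)

  natF : ℕ → Carrier
  natF zero    = 0#
  natF (suc m) = 1# + natF m

  CharZero : Set ℓ
  CharZero = ∀ m → ¬ (natF (suc m) ≈ 0#)

  Infinite : Set (c ⊔ ℓ)
  Infinite = ¬ (Σ (List Carrier) λ xs → ∀ x → Any (x ≈_) xs)

  Mat : ℕ → Set c
  Mat n = Fin n → Fin n → Carrier

  _≈M_ : ∀ {n} → Mat n → Mat n → Set ℓ
  M ≈M N = ∀ i j → M i j ≈ N i j

  _+M_ : ∀ {n} → Mat n → Mat n → Mat n
  (M +M N) i j = M i j + N i j

  sumFin : ∀ {n} → (Fin n → Carrier) → Carrier
  sumFin {zero}  f = 0#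
  sumFin {suc n} f = f zero + sumFin (λ i → f (suc i))

  sgn : ℕ → Carrier
  sgn zero    = 1#
  sgn (suc k) = - sgn k

  det : ∀ {n} → Mat n → Carrier
  det {zero}  M = 1#
  det {suc n} M =
    sumFin (λ j → (sgn (Data.Fin.toℕ j) * M zero j)
                  * det (λ i k → M (suc i) (punchIn j k)))

module _ {I : Set} {c : Level} (A : I → Set c) where
  Args : List I → Set c
  Args []       = ⊤
  Args (ξ ∷ ξs) = A ξ × Args ξs

record MSAlgebra (I : Set) (c ℓ : Level) : Set (lsuc (c ⊔ ℓ)) where
  field
    Phylum : I → Set c
    _≈_    : ∀ {ξ} → Phylum ξ → Phylum ξ → Set ℓ
    Op     : Set
    dom    : Op → List I
    cod    : Op → I
    op     : (o : Op) → Args Phylum (dom o) → Phylum (cod o)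

module RamseyAlg {I : Set} {c ℓ} (𝔸 : MSAlgebra I c ℓ) where
  open MSAlgebra 𝔸

  -- Term ds ξ : an orderly term with argument sorts ds
  -- (in order, each variable used exactly once) and value in phylum ξ.
  -- var ξ is id_{A_ξ};  app g (h₁ ∷ … ∷ h_N) is g(h₁(x⃗₁),…,h_N(x⃗_N)) with
  -- argument list x⃗₁ ∗ ⋯ ∗ x⃗_N.
  data Term : List I → I → Set
  data Terms : List I → List I → Set

  data Term where
    var : ∀ ξ → Term (ξ ∷ []) ξ
    app : ∀ {ds} (g : Op) → Terms ds (dom g) → Term ds (cod g)

  data Terms where
    []  : Terms [] []
    _∷_ : ∀ {d ds ξ ξs} → Term d ξ → Terms ds ξs → Terms (d ++ ds) (ξ ∷ ξs)

  splitArgs : ∀ d {ds} → Args Phylum (d ++ ds) → Args Phylum d × Args Phylum ds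
  splitArgs []      xs       = _ , xs
  splitArgs (_ ∷ d) (x , xs) with splitArgs d xs
  ... | ys , zs = (x , ys) , zs

  eval  : ∀ {ds ξ}  → Term ds ξ   → Args Phylum ds → Phylum ξ
  evals : ∀ {ds ξs} → Terms ds ξs → Args Phylum ds → Args Phylum ξs
  eval (var ξ)   (x , _) = x
  eval (app g t) xs      = op g (evals t xs)
  evals []            _  = _
  evals (_∷_ {d} t ts) xs with splitArgs d xs
  ... | ys , zs = eval t ys , evals ts zs

  Sort : Set
  Sort = ℕ → I

  Seq : Sort → Set c
  Seq e = (i : ℕ) → Phylum (e i)

  pick : ∀ {e} → Seq e → (is : List ℕ) → Args Phylum (map e is)
  pick b []       = _
  pick b (i ∷ is) = b i , pick b is

  data Increasing : List ℕ → Set where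
    []  : Increasing []
    _∷_ : ∀ {i is} → (∀ {k} → k ∈ is → i < k) → Increasing is → Increasing (i ∷ is)

  -- a⃗ ≤_𝓕 b⃗ : a(j) = f_j(b⃗_j) with f_j ∈ OT(𝓕), b⃗_j the finite subsequence of b⃗
  -- at positions idx j, and b⃗₀ ∗ b⃗₁ ∗ ⋯ a subsequence of b⃗.
  record _≤𝓕_ {e' e : Sort} (a : Seq e') (b : Seq e) : Set (c ⊔ ℓ) where
    field
      idx      : ℕ → List ℕ
      incr     : ∀ j → Increasing (idx j)
      blocks   : ∀ {j j' k k'} → j < j' → k ∈ idx j → k' ∈ idx j' → k < k'
      term     : ∀ j → Term (map e (idx j)) (e' j)
      witness  : ∀ j → a j ≈ eval (term j) (pick b (idx j))

  _∈FR_ : ∀ {e : Sort} → Phylum (e 0) → Seq e → Set (c ⊔ ℓ)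
  _∈FR_ {e} x b = Σ (Seq e) λ a → (a ≤𝓕 b) × (a 0 ≈ x)

  record Subset (ξ : I) : Set (lsuc (c ⊔ ℓ)) where
    field
      _∈X    : Phylum ξ → Set (c ⊔ ℓ)
      respects : ∀ {x y} → x ≈ y → x ∈X → y ∈X

  IsRamsey : Sort → Set (lsuc (c ⊔ ℓ))
  IsRamsey e =
    (b : Seq e) (X : Subset (e 0)) →
    Σ (Seq e) λ a → (a ≤𝓕 b) ×
      ((∀ x → x ∈FR a → Subset._∈X X x) ⊎ (∀ x → x ∈FR a → ¬ Subset._∈X X x))

  InΩ : Sort → Set
  InΩ e = ∀ ξ m → Σ ℕ λ k → (m ≤ k) × (e k ≡ ξ)

  Nonconstant : Sort → Set
  Nonconstant e = Σ ℕ λ i → ¬ (e i ≡ e 0)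

module _ {c ℓ} (F : Field c ℓ) (n : ℕ) where
  open Field F using (Carrier; _≈_; _+_; _*_)

  Phy : Fin 2 → Set c
  Phy zero       = Carrier
  Phy (suc zero) = Mat F n

  EqPhy : ∀ {ξ} → Phy ξ → Phy ξ → Set ℓ
  EqPhy {zero}       = _≈_
  EqPhy {suc zero}   = _≈M_ F

  data Ops₁ : Set where
    matAdd fieldMul det₁ : Ops₁

  data Ops₂ : Set where
    matAdd fieldAdd fieldMul det₂ : Ops₂

  MatAlg₁ : MSAlgebra (Fin 2) c ℓ
  MatAlg₁ = record
    { Phylum = Phy ; _≈_ = λ {ξ} → EqPhy {ξ} ; Op = Ops₁ ; dom = dm ; cod = cd ; op = o }
    where
    dm : Ops₁ → List (Fin 2)
    dm matAdd   = suc zero ∷ suc zero ∷ []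
    dm fieldMul = zero ∷ zero ∷ []
    dm det₁     = suc zero ∷ []
    cd : Ops₁ → Fin 2
    cd matAdd   = suc zero
    cd fieldMul = zero
    cd det₁     = zero
    o : (g : Ops₁) → Args Phy (dm g) → Phy (cd g)
    o matAdd   (M , N , _) = _+M_ F M N
    o fieldMul (x , y , _) = x * y
    o det₁     (M , _)     = det F M

  MatAlg₂ : MSAlgebra (Fin 2) c ℓ
  MatAlg₂ = record
    { Phylum = Phy ; _≈_ = λ {ξ} → EqPhy {ξ} ; Op = Ops₂ ; dom = dm ; cod = cd ; op = o }
    where
    dm : Ops₂ → List (Fin 2)
    dm matAdd   = suc zero ∷ suc zero ∷ []
    dm fieldAdd = zero ∷ zero ∷ []
    dm fieldMul = zero ∷ zero ∷ []
    dm det₂     = suc zero ∷ []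
    cd : Ops₂ → Fin 2
    cd matAdd   = suc zero
    cd fieldAdd = zero
    cd fieldMul = zero
    cd det₂     = zero
    o : (g : Ops₂) → Args Phy (dm g) → Phy (cd g)
    o matAdd   (M , N , _) = _+M_ F M N
    o fieldAdd (x , y , _) = x + y
    o fieldMul (x , y , _) = x * y
    o det₂     (M , _)     = det F M

module Submission where

-- Call a matrix signed if it is diagonal with negative first entry and
-- positive other entries ("positive" = 1 + ⋯ + 1).  Signed matrices are closed
-- under + and have negative determinant.  Let b be diag(-1,1,…,1) at matrix
-- positions.  Orderly terms can only add matrices, so every a ≤_𝓕 b consists
-- of signed matrices; for X = the positive scalars, FR(a) then contains
-- det(a_k) ∉ X and det(a_k)·det(a_k') ∈ X (k < k'), so no a is homogeneous.

open import Level using (Lift; lift; lower; _⊔_) renaming (suc to lsuc)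
open import Data.Nat using (ℕ; zero; suc; _<_; _≤_; s≤s) renaming (_+_ to _+ℕ_; _*_ to _*ℕ_)
open import Data.Nat.Properties using (m≤n⇒m<n∨m≡n; ≤-<-trans; <-trans; ≤-refl; <⇒≤)
open import Data.Fin using (Fin; zero; suc; toℕ; punchIn)
open import Data.List using (List; []; _∷_; _++_; map)
open import Data.List.Membership.Propositional using (_∈_)
open import Data.List.Relation.Unary.Any using (here; there)
open import Data.Product using (Σ; _×_; _,_; proj₁; proj₂)
open import Data.Sum using (inj₁; inj₂)
open import Data.Empty using (⊥)
open import Data.Unit.Polymorphic using (⊤)
open import Relation.Nullary using (¬_)
open import Relation.Binary.PropositionalEquality using (_≡_; refl; cong; cong₂)
import Algebra.Properties.Ring as RingProperties
import Algebra.Properties.Semiring.Mult as SemiringMult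
import Relation.Binary.Reasoning.Setoid as SetoidReasoning
open import Defs

module General {I : Set} {c ℓ} (𝔸 : MSAlgebra I c ℓ) where
  open MSAlgebra 𝔸
  open RamseyAlg 𝔸

  module _ {p} (P : ∀ {ξ} → Phylum ξ → Set p) where

    AllP : ∀ ds → Args Phylum ds → Set p
    AllP []       _        = ⊤
    AllP (_ ∷ ds) (x , xs) = P x × AllP ds xs

    AllP-split : ∀ d {ds} (xs : Args Phylum (d ++ ds)) → AllP (d ++ ds) xs →
      AllP d (proj₁ (splitArgs d xs)) × AllP ds (proj₂ (splitArgs d xs))
    AllP-split []      xs       h         = _ , h
    AllP-split (_ ∷ d) (x , xs) (px , h) with splitArgs d xs | AllP-split d xs h
    ... | _ , _ | hys , hzs = (px , hys) , hzs

    AllP-pick : ∀ {e} (b : Seq e) → (∀ i → P (b i)) → ∀ is → AllP (map e is) (pick b is)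
    AllP-pick b pb []       = _
    AllP-pick b pb (i ∷ is) = pb i , AllP-pick b pb is

    Closed : Set (c ⊔ p)
    Closed = ∀ g xs → AllP (dom g) xs → P (op g xs)

    eval-closed  : Closed → ∀ {ds ξ} (t : Term ds ξ) xs → AllP ds xs → P (eval t xs)
    evals-closed : Closed → ∀ {ds ξs} (ts : Terms ds ξs) xs → AllP ds xs → AllP ξs (evals ts xs)
    eval-closed closed (var ξ)   (x , _) (px , _) = px
    eval-closed closed (app g t) xs      h        = closed g _ (evals-closed closed t xs h)
    evals-closed closed []               xs h = _
    evals-closed closed (_∷_ {d} t ts) xs h with splitArgs d xs | AllP-split d xs h
    ... | ys , zs | hys , hzs = eval-closed closed t ys hys , evals-closed closed ts zs hzs

    ≤𝓕-invariant : Closed → (∀ {ξ} {x y : Phylum ξ} → x ≈ y → P y → P x) →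
      ∀ {e e'} {a : Seq e'} {b : Seq e} → (∀ i → P (b i)) → a ≤𝓕 b → ∀ j → P (a j)
    ≤𝓕-invariant closed resp {b = b} pb a≤b j =
      resp (witness j) (eval-closed closed (term j) _ (AllP-pick b pb (idx j)))
      where open _≤𝓕_ a≤b

  -- Moving elements and terms along equalities of phylum indices (needed because
  -- the sort e only equals the phyla it takes at chosen positions propositionally).
  cast : ∀ {ξ ξ'} → ξ ≡ ξ' → Phylum ξ → Phylum ξ'
  cast refl x = x

  cast-cong : ∀ {ξ ξ'} (q : ξ ≡ ξ') {x y : Phylum ξ} → x ≈ y → cast q x ≈ cast q y
  cast-cong refl x≈y = x≈y

  retype : ∀ {ds ds' ξ ξ'} → ds' ≡ ds → ξ' ≡ ξ → Term ds ξ → Term ds' ξ'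
  retype refl refl t = t

  retype-eval : ∀ {p q} (P : ∀ {ξ} → Phylum ξ → Set p) {ds ds' ξ ξ'}
    (r : ds' ≡ ds) (s : ξ' ≡ ξ) (t : Term ds ξ) (Q : Phylum ξ → Set q) →
    (∀ xs → AllP P ds xs → Q (eval t xs)) →
    ∀ xs → AllP P ds' xs → Q (cast s (eval (retype r s t) xs))
  retype-eval P refl refl t Q h = h

  cast-var : ∀ {ξ ξ'} → ξ ≡ ξ' → Term (ξ ∷ []) ξ'
  cast-var refl = var _

  record Separation {p} (ξ₀ : I) : Set (c ⊔ lsuc (ℓ ⊔ p)) where
    field
      P          : ∀ {ξ} → Phylum ξ → Set p
      P-resp     : ∀ {ξ} {x y : Phylum ξ} → x ≈ y → P y → P x
      P-closed   : Closed P
      base       : ∀ ξ → Phylum ξ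
      base-P     : ∀ ξ → P (base ξ)
      Q          : Phylum ξ₀ → Set ℓ
      Q-resp     : ∀ {x y} → x ≈ y → Q x → Q y
      ξ₁         : I
      t₁         : Term (ξ₁ ∷ []) ξ₀
      t₁-outside : ∀ xs → AllP P (ξ₁ ∷ []) xs → ¬ Q (eval t₁ xs)
      t₂         : Term (ξ₁ ∷ ξ₁ ∷ []) ξ₀
      t₂-inside  : ∀ xs → AllP P (ξ₁ ∷ ξ₁ ∷ []) xs → Q (eval t₂ xs)

  module _ (≈-refl : ∀ {ξ} (x : Phylum ξ) → x ≈ x) where

    cast-var-eval : ∀ {ξ ξ'} (q : ξ ≡ ξ') (x : Phylum ξ) → cast q x ≈ eval (cast-var q) (x , _)
    cast-var-eval refl x = ≈-refl x

    module _ {e : Sort} (Ω : InΩ e) where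

      -- Since every phylum recurs in e, from any position l on we can pick
      -- strictly increasing positions follow l 1, follow l 2, … of sorts e 1, e 2, ….
      follow : ℕ → ℕ → ℕ
      follow l zero    = l
      follow l (suc j) = proj₁ (Ω (e (suc j)) (suc (follow l j)))

      follow-sort : ∀ l j → e (follow l (suc j)) ≡ e (suc j)
      follow-sort l j = proj₂ (proj₂ (Ω (e (suc j)) (suc (follow l j))))

      follow-step : ∀ l j → follow l j < follow l (suc j)
      follow-step l j = proj₁ (proj₂ (Ω (e (suc j)) (suc (follow l j))))

      follow-mono : ∀ l {j j'} → j < j' → follow l j < follow l j'
      follow-mono l {j} {suc j'} (s≤s j≤j') with m≤n⇒m<n∨m≡n j≤j'
      ... | inj₁ j<j' = <-trans (follow-mono l j<j') (follow-step l j')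
      ... | inj₂ refl = follow-step l j

      -- In an Ω-sort, the value of any term on an increasing finite
      -- subsequence of a lies in FR(a): complete it to a' ≤_𝓕 a by
      -- entries of a taken at the positions follow l 1, follow l 2, ….
      term-∈FR : (a : Seq e) (L : List ℕ) (l : ℕ) → Increasing L → (∀ {k} → k ∈ L → k ≤ l) →
        (t : Term (map e L) (e 0)) → eval t (pick a L) ∈FR a
      term-∈FR a L l incL bounded t = a' , a'≤a , ≈-refl _
        where
        a' : Seq e
        a' zero    = eval t (pick a L)
        a' (suc j) = cast (follow-sort l j) (a (follow l (suc j)))

        idx : ℕ → List ℕ
        idx zero    = L
        idx (suc j) = follow l (suc j) ∷ []

        incr : ∀ j → Increasing (idx j)
        incr zero    = incL
        incr (suc j) = (λ ()) ∷ []

        idx-bound : ∀ j {k} → k ∈ idx j → k ≤ follow l j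
        idx-bound zero    k∈L          = bounded k∈L
        idx-bound (suc j) (here refl) = ≤-refl

        blocks : ∀ {j j' k k'} → j < j' → k ∈ idx j → k' ∈ idx j' → k < k'
        blocks {j} {suc j'} j<j' k∈ (here refl) = ≤-<-trans (idx-bound j k∈) (follow-mono l j<j')

        term : ∀ j → Term (map e (idx j)) (e j)
        term zero    = t
        term (suc j) = cast-var (follow-sort l j)

        witness : ∀ j → a' j ≈ eval (term j) (pick a (idx j))
        witness zero    = ≈-refl _
        witness (suc j) = cast-var-eval (follow-sort l j) _

        a'≤a : a' ≤𝓕 a
        a'≤a = record { idx = idx ; incr = incr ; blocks = blocks ; term = term ; witness = witness }

    module _ {p ξ₀} (S : Separation {p} ξ₀) {e : Sort} (Ω : InΩ e) (e0 : e 0 ≡ ξ₀) where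
      open Separation S

      k₁ k₂ : ℕ
      k₁ = proj₁ (Ω ξ₁ 0)
      k₂ = proj₁ (Ω ξ₁ (suc k₁))

      k₁<k₂ : k₁ < k₂
      k₁<k₂ = proj₁ (proj₂ (Ω ξ₁ (suc k₁)))

      sort₁ : map e (k₁ ∷ []) ≡ ξ₁ ∷ []
      sort₁ = cong (_∷ []) (proj₂ (proj₂ (Ω ξ₁ 0)))

      sort₂ : map e (k₁ ∷ k₂ ∷ []) ≡ ξ₁ ∷ ξ₁ ∷ []
      sort₂ = cong₂ _∷_ (proj₂ (proj₂ (Ω ξ₁ 0))) (cong (_∷ []) (proj₂ (proj₂ (Ω ξ₁ (suc k₁)))))

      X : Subset (e 0)
      X = record { _∈X = λ x → Lift c (Q (cast e0 x))
                 ; respects = λ x≈y x∈X → lift (Q-resp (cast-cong e0 x≈y) (lower x∈X)) }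
      open Subset X using (_∈X)

      FR-not-inside : (a : Seq e) → (∀ j → P (a j)) → ¬ (∀ x → x ∈FR a → x ∈X)
      FR-not-inside a a-P all-in =
        retype-eval P sort₁ e0 t₁ (λ v → ¬ Q v) t₁-outside _ (AllP-pick P a a-P L)
          (lower (all-in _ (term-∈FR Ω a L k₁ ((λ ()) ∷ []) (λ { (here refl) → ≤-refl }) u)))
        where
        L : List ℕ
        L = k₁ ∷ []
        u : Term (map e L) (e 0)
        u = retype sort₁ e0 t₁

      FR-not-outside : (a : Seq e) → (∀ j → P (a j)) → ¬ (∀ x → x ∈FR a → ¬ x ∈X)
      FR-not-outside a a-P all-out =
        all-out _ (term-∈FR Ω a L k₂ ((λ { (here refl) → k₁<k₂ }) ∷ (λ ()) ∷ [])
                     (λ { (here refl) → <⇒≤ k₁<k₂ ; (there (here refl)) → ≤-refl }) u)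
          (lift (retype-eval P sort₂ e0 t₂ Q t₂-inside _ (AllP-pick P a a-P L)))
        where
        L : List ℕ
        L = k₁ ∷ k₂ ∷ []
        u : Term (map e L) (e 0)
        u = retype sort₂ e0 t₂

      base-seq : Seq e
      base-seq i = base (e i)

      below-base-P : ∀ {a : Seq e} → a ≤𝓕 base-seq → ∀ j → P (a j)
      below-base-P = ≤𝓕-invariant P P-closed P-resp (λ i → base-P (e i))

      separation⇒not-Ramsey : ¬ IsRamsey e
      separation⇒not-Ramsey ramsey with ramsey base-seq X
      ... | a , a≤b , inj₁ all-in  = FR-not-inside a (below-base-P a≤b) all-in
      ... | a , a≤b , inj₂ all-out = FR-not-outside a (below-base-P a≤b) all-out

module Positivity {c ℓ} (F : Field c ℓ) where
  open Field F hiding (zero) renaming (refl to ≈-refl)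
  open RingProperties ring using (-‿distribˡ-*; -‿distribʳ-*; -‿+-comm; -‿involutive)
  open SemiringMult semiring using (×-homo-+; ×1-homo-*) renaming (_×_ to _·_)
  open SetoidReasoning setoid

  Positive : Carrier → Set ℓ
  Positive x = Σ ℕ λ r → x ≈ suc r · 1#

  Negative : Carrier → Set ℓ
  Negative x = Positive (- x)

  positive-resp : ∀ {x y} → x ≈ y → Positive x → Positive y
  positive-resp x≈y (r , x≈r) = r , trans (sym x≈y) x≈r

  negative-resp : ∀ {x y} → x ≈ y → Negative x → Negative y
  negative-resp x≈y = positive-resp (-‿cong x≈y)

  positive-1 : Positive 1#
  positive-1 = 0 , sym (+-identityʳ 1#)

  negative-−1 : Negative (- 1#)
  negative-−1 = positive-resp (sym (-‿involutive 1#)) positive-1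

  positive-+ : ∀ {x y} → Positive x → Positive y → Positive (x + y)
  positive-+ {x} {y} (r , x≈r) (s , y≈s) = r +ℕ suc s , (begin
    x + y                   ≈⟨ +-cong x≈r y≈s ⟩
    suc r · 1# + suc s · 1# ≈⟨ ×-homo-+ 1# (suc r) (suc s) ⟨
    (suc r +ℕ suc s) · 1#    ∎)

  positive-* : ∀ {x y} → Positive x → Positive y → Positive (x * y)
  positive-* {x} {y} (r , x≈r) (s , y≈s) = s +ℕ r *ℕ suc s , (begin
    x * y                     ≈⟨ *-cong x≈r y≈s ⟩
    (suc r · 1#) * (suc s · 1#) ≈⟨ ×1-homo-* (suc r) (suc s) ⟨
    (suc r *ℕ suc s) · 1#      ∎)

  negative-+ : ∀ {x y} → Negative x → Negative y → Negative (x + y)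
  negative-+ {x} {y} nx ny = positive-resp (-‿+-comm x y) (positive-+ nx ny)

  negative-*-positive : ∀ {x y} → Negative x → Positive y → Negative (x * y)
  negative-*-positive {x} {y} nx py = positive-resp (sym (-‿distribˡ-* x y)) (positive-* nx py)

  negative-*-negative : ∀ {x y} → Negative x → Negative y → Positive (x * y)
  negative-*-negative {x} {y} nx ny = positive-resp neg-neg (positive-* nx ny)
    where
    neg-neg : - x * - y ≈ x * y
    neg-neg = begin
      - x * - y     ≈⟨ -‿distribˡ-* x (- y) ⟨
      - (x * - y)   ≈⟨ -‿cong (-‿distribʳ-* x y) ⟨
      - (- (x * y)) ≈⟨ -‿involutive (x * y) ⟩
      x * y         ∎

  natF≈· : ∀ m → natF F m ≈ m · 1#
  natF≈· zero    = ≈-refl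
  natF≈· (suc m) = +-congˡ (natF≈· m)

  -- In characteristic 0 no element is both positive and negative:
  -- otherwise 0 ≈ x + (- x) would be a positive integer.
  positive∧negative-absurd : CharZero F → ∀ {x} → Positive x → Negative x → ⊥
  positive∧negative-absurd charZero {x} px nx with positive-+ px nx
  ... | r , x-x≈r = charZero r (begin
    natF F (suc r) ≈⟨ natF≈· (suc r) ⟩
    suc r · 1#     ≈⟨ x-x≈r ⟨
    x + - x        ≈⟨ -‿inverseʳ x ⟩
    0#             ∎)

module SignedMatrices {c ℓ} (F : Field c ℓ) where
  open Field F hiding (zero) renaming (refl to ≈-refl)
  open Positivity F
  open SetoidReasoning setoid

  diag : ∀ {n} → (Fin n → Carrier) → Mat F n
  diag d zero    zero    = d zero
  diag d zero    (suc j) = 0#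
  diag d (suc i) zero    = 0#
  diag d (suc i) (suc j) = diag (λ k → d (suc k)) i j

  diag-+ : ∀ {n} (d d' : Fin n → Carrier) →
    _≈M_ F (_+M_ F (diag d) (diag d')) (diag (λ i → d i + d' i))
  diag-+ d d' zero    zero    = ≈-refl
  diag-+ d d' zero    (suc j) = +-identityˡ 0#
  diag-+ d d' (suc i) zero    = +-identityˡ 0#
  diag-+ d d' (suc i) (suc j) = diag-+ (λ k → d (suc k)) (λ k → d' (suc k)) i j

  sumFin-cong : ∀ {n} {f g : Fin n → Carrier} → (∀ i → f i ≈ g i) → sumFin F f ≈ sumFin F g
  sumFin-cong {zero}  f≈g = ≈-refl
  sumFin-cong {suc n} f≈g = +-cong (f≈g zero) (sumFin-cong (λ i → f≈g (suc i)))

  sumFin-zero : ∀ {n} {f : Fin n → Carrier} → (∀ i → f i ≈ 0#) → sumFin F f ≈ 0#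
  sumFin-zero {zero}  f≈0 = ≈-refl
  sumFin-zero {suc n} f≈0 = trans (+-cong (f≈0 zero) (sumFin-zero (λ i → f≈0 (suc i)))) (+-identityˡ 0#)

  det-cong : ∀ {n} {M N : Mat F n} → _≈M_ F M N → det F M ≈ det F N
  det-cong {zero}  M≈N = ≈-refl
  det-cong {suc n} M≈N = sumFin-cong λ j →
    *-cong (*-congˡ {sgn F (toℕ j)} (M≈N zero j)) (det-cong (λ i k → M≈N (suc i) (punchIn j k)))

  -- Expanding along the first row, only the diagonal entry contributes.
  det-diag : ∀ {n} (d : Fin (suc n) → Carrier) →
    det F (diag d) ≈ d zero * det F (diag (λ k → d (suc k)))
  det-diag {n} d = begin
    det F (diag d)         ≈⟨ +-congˡ (sumFin-zero {n} λ j → off-diagonal j) ⟩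
    (1# * d zero) * D + 0# ≈⟨ +-identityʳ _ ⟩
    (1# * d zero) * D      ≈⟨ *-congʳ (*-identityˡ (d zero)) ⟩
    d zero * D             ∎
    where
    D : Carrier
    D = det F (diag (λ k → d (suc k)))
    off-diagonal : ∀ j {y} → (sgn F (suc (toℕ j)) * 0#) * y ≈ 0#
    off-diagonal j = trans (*-congʳ (zeroʳ _)) (zeroˡ _)

  det-positive : ∀ {n} (d : Fin n → Carrier) → (∀ i → Positive (d i)) → Positive (det F (diag d))
  det-positive {zero}  d pd = positive-1
  det-positive {suc n} d pd =
    positive-resp (sym (det-diag d)) (positive-* (pd zero) (det-positive (λ k → d (suc k)) (λ k → pd (suc k))))

  Signed : ∀ {n} → Mat F (suc n) → Set (c ⊔ ℓ)
  Signed {n} M = Σ (Fin (suc n) → Carrier) λ d →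
    _≈M_ F M (diag d) × Negative (d zero) × (∀ i → Positive (d (suc i)))

  signed-resp : ∀ {n} {M N : Mat F (suc n)} → _≈M_ F M N → Signed N → Signed M
  signed-resp M≈N (d , N≈d , sign) = d , (λ i j → trans (M≈N i j) (N≈d i j)) , sign

  signed-+ : ∀ {n} {M N : Mat F (suc n)} → Signed M → Signed N → Signed (_+M_ F M N)
  signed-+ (d , M≈d , nd , pd) (d' , N≈d' , nd' , pd') =
    (λ i → d i + d' i) ,
    (λ i j → trans (+-cong (M≈d i j) (N≈d' i j)) (diag-+ d d' i j)) ,
    negative-+ nd nd' ,
    λ i → positive-+ (pd i) (pd' i)

  signed-det : ∀ {n} {M : Mat F (suc n)} → Signed M → Negative (det F M)
  signed-det (d , M≈d , nd , pd) =
    negative-resp (sym (trans (det-cong M≈d) (det-diag d)))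
      (negative-*-positive nd (det-positive (λ k → d (suc k)) pd))

  −1,1…1 : ∀ {n} → Fin (suc n) → Carrier
  −1,1…1 zero    = - 1#
  −1,1…1 (suc i) = 1#

  signed-−1,1…1 : ∀ {n} → Signed (diag (−1,1…1 {n}))
  signed-−1,1…1 = −1,1…1 , (λ i j → ≈-refl) , negative-−1 , λ i → positive-1

module MatrixAlgebras {c ℓ} (F : Field c ℓ) (charZero : CharZero F) (k : ℕ) where
  open Field F using (_*_; 1#) renaming (refl to ≈-refl)
  open Positivity F
  open SignedMatrices F

  Φ : Fin 2 → Set c
  Φ = Phy F (suc k)

  Φ-refl : ∀ {ξ} (x : Φ ξ) → EqPhy F (suc k) {ξ} x x
  Φ-refl {zero}     x = ≈-refl
  Φ-refl {suc zero} M = λ i j → ≈-refl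

  SignedΦ : ∀ {ξ} → Φ ξ → Set (c ⊔ ℓ)
  SignedΦ {zero}     x = ⊤
  SignedΦ {suc zero} M = Signed M

  SignedΦ-resp : ∀ {ξ} {x y : Φ ξ} → EqPhy F (suc k) {ξ} x y → SignedΦ {ξ} y → SignedΦ {ξ} x
  SignedΦ-resp {zero}     x≈y _  = _
  SignedΦ-resp {suc zero} M≈N sN = signed-resp M≈N sN

  base : ∀ ξ → Φ ξ
  base zero       = 1#
  base (suc zero) = diag −1,1…1

  base-signed : ∀ ξ → SignedΦ {ξ} (base ξ)
  base-signed zero       = _
  base-signed (suc zero) = signed-−1,1…1 {k}

  det-not-positive : ∀ {M : Mat F (suc k)} → Signed M → ¬ Positive (det F M)
  det-not-positive sM pM = positive∧negative-absurd charZero pM (signed-det sM)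

  det*det-positive : ∀ {M N : Mat F (suc k)} → Signed M → Signed N → Positive (det F M * det F N)
  det*det-positive sM sN = negative-*-negative (signed-det sM) (signed-det sN)

  -- (𝓜ₖ₊₁(F), F, +, ×_F, |∗|): only + produces matrices, so signedness is
  -- invariant; the separating terms are |x| and |x|·|y|.
  module Alg₁ where
    open General (MatAlg₁ F (suc k))
    open RamseyAlg (MatAlg₁ F (suc k))

    signed-closed : Closed (λ {ξ} → SignedΦ {ξ})
    signed-closed matAdd   (M , N , _) (sM , sN , _) = signed-+ {M = M} {N} sM sN
    signed-closed fieldMul _           _             = _
    signed-closed det₁     _           _             = _

    |x| : Term (suc zero ∷ []) zero
    |x| = app det₁ (var (suc zero) ∷ [])

    separation : Separation {c ⊔ ℓ} zero
    separation = record
      { P = λ {ξ} → SignedΦ {ξ} ; P-resp = λ {ξ} → SignedΦ-resp {ξ} ; P-closed = signed-closed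
      ; base = base ; base-P = base-signed
      ; Q = Positive ; Q-resp = positive-resp ; ξ₁ = suc zero
      ; t₁ = |x| ; t₁-outside = λ { (M , _) (sM , _) → det-not-positive {M} sM }
      ; t₂ = app fieldMul (|x| ∷ |x| ∷ [])
      ; t₂-inside = λ { (M , N , _) (sM , sN , _) → det*det-positive {M} {N} sM sN } }

    not-Ramsey : ∀ e → InΩ e → e 0 ≡ zero → ¬ IsRamsey e
    not-Ramsey e inΩ e0≡0 = separation⇒not-Ramsey (λ {ξ} → Φ-refl {ξ}) separation inΩ e0≡0

  -- (𝓜ₖ₊₁(F), F, +, +_F, ×_F, |∗|): the same argument, +_F acting on scalars only.
  module Alg₂ where
    open General (MatAlg₂ F (suc k))
    open RamseyAlg (MatAlg₂ F (suc k))

    signed-closed : Closed (λ {ξ} → SignedΦ {ξ})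
    signed-closed matAdd   (M , N , _) (sM , sN , _) = signed-+ {M = M} {N} sM sN
    signed-closed fieldAdd _           _             = _
    signed-closed fieldMul _           _             = _
    signed-closed det₂     _           _             = _

    |x| : Term (suc zero ∷ []) zero
    |x| = app det₂ (var (suc zero) ∷ [])

    separation : Separation {c ⊔ ℓ} zero
    separation = record
      { P = λ {ξ} → SignedΦ {ξ} ; P-resp = λ {ξ} → SignedΦ-resp {ξ} ; P-closed = signed-closed
      ; base = base ; base-P = base-signed
      ; Q = Positive ; Q-resp = positive-resp ; ξ₁ = suc zero
      ; t₁ = |x| ; t₁-outside = λ { (M , _) (sM , _) → det-not-positive {M} sM }
      ; t₂ = app fieldMul (|x| ∷ |x| ∷ [])
      ; t₂-inside = λ { (M , N , _) (sM , sN , _) → det*det-positive {M} {N} sM sN } }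

    not-Ramsey : ∀ e → InΩ e → e 0 ≡ zero → ¬ IsRamsey e
    not-Ramsey e inΩ e0≡0 = separation⇒not-Ramsey (λ {ξ} → Φ-refl {ξ}) separation inΩ e0≡0

-- Theorem 16.
mainTheorem16 : ∀ {c ℓ} (F : Field c ℓ) → Infinite F → CharZero F →
    (n : ℕ) → 1 ≤ n → (e : ℕ → Fin 2) →
    RamseyAlg.InΩ (MatAlg₁ F n) e → e 0 ≡ zero → RamseyAlg.Nonconstant (MatAlg₁ F n) e →
    ¬ RamseyAlg.IsRamsey (MatAlg₁ F n) e × ¬ RamseyAlg.IsRamsey (MatAlg₂ F n) e
mainTheorem16 F _ charZero (suc k) (s≤s _) e inΩ e0≡0 _ =
  Alg₁.not-Ramsey e inΩ e0≡0 , Alg₂.not-Ramsey e inΩ e0≡0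
  where open MatrixAlgebras F charZero k
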